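{- Let $\omega=\frac{ -1+\sqrt{ -3}}{2}$. For an irreducible fraction $\frac{r}{s}$, we have $s\equiv r\pmod 3$ if and only if $\mathcal{R}_{\frac{r}{s}}(\omega)=\mathcal{S}_{\frac{r}{s}}(\omega)$.
   Context: For an integer $c$, $[c]_q=\frac{1-q^c}{1-q}$. Every rational $\alpha>1$ has a unique negative continued fraction expansion $\alpha=c_1-\cfrac{1}{c_2-\cfrac{1}{\ddots-\cfrac{1}{c_l}}}$ with integers $c_j\ge 2$. Put $M^-_q(c)=\begin{pmatrix}[c]_q & -q^{c-1}\\ 1 & 0\end{pmatrix}$ and define $\mathcal{R}_\alpha(q),\mathcal{S}_\alpha(q)$ by $\begin{pmatrix}\mathcal{R}_\alpha(q)\\ \mathcal{S}_\alpha(q)\end{pmatrix}=M^-_q(c_1)\cdots M^-_q(c_l)\begin{pmatrix}1\\0\end{pmatrix}$. For rational $\alpha\le 1$ they are defined recursively by $\mathcal{S}_\alpha(q)=\mathcal{S}_{\alpha+1}(q)$ and $\mathcal{R}_\alpha(q)=q^{ -1}(\mathcal{R}_{\alpha+1}(q)-\mathcal{S}_{\alpha+1}(q))$ (Laurent polynomials). An irreducible fraction $\frac{r}{s}$ means $\gcd(r,s)=1$, $s>0$. -}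

module Defs where

open import Data.Nat as ℕ using (ℕ; zero; suc; _/_)
open import Data.Integer as ℤ using (ℤ; +_; ∣_∣; _<?_)
open import Data.Product using (_×_; _,_; proj₁; proj₂)
open import Data.List using (List; []; _∷_)
open import Relation.Nullary using (yes; no)
open import Function using (_∘_)

-- Eisenstein integers ℤ[ω], ω = (-1+√-3)/2, ω² = -1 - ω.
-- The element a + bω is represented by eis a b;
-- equality in ℤ[ω] is propositional equality of pairs.

record Eis : Set where
  constructor eis
  field
    re : ℤ
    im : ℤ
open Eis public

infixl 6 _⊕_ _⊖_
infixl 7 _⊗_

_⊕_ : Eis → Eis → Eis
eis a b ⊕ eis c d = eis (a ℤ.+ c) (b ℤ.+ d)

⊝_ : Eis → Eis
⊝ eis a b = eis (ℤ.- a) (ℤ.- b)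

_⊖_ : Eis → Eis → Eis
x ⊖ y = x ⊕ (⊝ y)

-- (a + bω)(c + dω) = (ac - bd) + (ad + bc - bd)ω   using ω² = -1 - ω
_⊗_ : Eis → Eis → Eis
eis a b ⊗ eis c d =
  eis (a ℤ.* c ℤ.- b ℤ.* d) (a ℤ.* d ℤ.+ b ℤ.* c ℤ.- b ℤ.* d)

𝟘 𝟙 ω ω⁻¹ : Eis
𝟘 = eis (+ 0) (+ 0)
𝟙 = eis (+ 1) (+ 0)
ω = eis (+ 0) (+ 1)
-- ω⁻¹ = ω² = -1 - ω
ω⁻¹ = eis (ℤ.- + 1) (ℤ.- + 1)

ω^ : ℕ → Eis
ω^ zero = 𝟙
ω^ (suc n) = ω ⊗ ω^ n

-- [c]_q = (1 - q^c)/(1 - q) = 1 + q + ... + q^(c-1)  (c ≥ 0), evaluated at q = ω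
[_]ω : ℕ → Eis
[ zero ]ω = 𝟘
[ suc c ]ω = 𝟙 ⊕ ω ⊗ [ c ]ω

-- Negative continued fraction of r/s for naturals r > s ≥ 1:
--   r/s = c₁ - 1/(c₂ - 1/(… - 1/c_l)),  c_j ≥ 2.
-- Algorithm: c₁ = ⌈r/s⌉; if c₁ s = r we are done, otherwise
-- r/s = c₁ - 1/(s/(c₁ s - r)) with 0 < c₁ s - r < s.
-- The first argument is fuel; fuel = s always suffices since the
-- denominator strictly decreases and stays ≥ 1.

ncf : ℕ → ℕ → ℕ → List ℕ
ncf zero    r s       = []
ncf (suc f) r zero    = []
ncf (suc f) r (suc t) with (r ℕ.+ t) / suc t
... | c with c ℕ.* suc t ℕ.∸ r
...   | zero    = c ∷ []
...   | suc d   = c ∷ ncf f (suc t) (suc d)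

-- M⁻_ω(c₁) ⋯ M⁻_ω(c_l) (1 , 0)ᵀ, where M⁻_q(c) = ([c]_q , -q^(c-1) ; 1 , 0)
applyM : List ℕ → Eis × Eis
applyM [] = 𝟙 , 𝟘
applyM (c ∷ cs) with applyM cs
... | x , y = [ c ]ω ⊗ x ⊖ ω^ (c ℕ.∸ 1) ⊗ y , x

-- one step of the recursion for α ≤ 1:
--   (R_{α+1}, S_{α+1}) ↦ (q⁻¹ (R_{α+1} - S_{α+1}), S_{α+1}) = (R_α, S_α)
stepDown : Eis × Eis → Eis × Eis
stepDown (x , y) = ω⁻¹ ⊗ (x ⊖ y) , y

iterate : ℕ → (Eis × Eis → Eis × Eis) → Eis × Eis → Eis × Eis
iterate zero    g p = p
iterate (suc n) g p = g (iterate n g p)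

-- (R_{r/s}(ω) , S_{r/s}(ω)) for r ∈ ℤ, s ≥ 1.
-- If r/s > 1 use the negative continued fraction; otherwise r/s + k > 1
-- with k = ⌊(s - r)/s⌋ + 1 (the least such k ≥ 1) and apply the
-- downward recursion k times.
RSω : ℤ → ℕ → Eis × Eis
RSω r zero = 𝟘 , 𝟘   -- junk: s > 0 is always assumed
RSω r (suc t) with + suc t <? r
... | yes _ = applyM (ncf (suc t) ∣ r ∣ (suc t))
... | no  _ = iterate k stepDown (applyM (ncf (suc t) r′ (suc t)))
  where
  k  = suc (∣ + suc t ℤ.- r ∣ / suc t)
  r′ = ∣ r ℤ.+ + (k ℕ.* suc t) ∣

Rω : ℤ → ℕ → Eis
Rω r s = proj₁ (RSω r s)

Sω : ℤ → ℕ → Eis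
Sω r s = proj₂ (RSω r s)

module Submission where

-- At q = ω the entries [c]_ω and ω^(c-1) of M⁻_ω(c) depend only on c mod 3. Hence, by
-- induction along the negative continued fraction of r/s (followed by the downward steps
-- (R, S) ↦ (ω⁻¹(R - S), S) when r/s ≤ 1), the pair (R_{r/s}(ω), S_{r/s}(ω)) is a unit
-- multiple of a representative pair shape (r mod 3) (s mod 3); each inductive step is a
-- finite check over the six units ±1, ±ω, ±ω² of ℤ[ω] and the residues mod 3. In the table
-- of representatives the two coordinates agree exactly when r ≡ s (mod 3).

open import Defs
open import Data.Nat using (ℕ; zero; suc; _+_; _*_; _∸_; _/_; _%_; _≤_; _<_; z≤n; s≤s)
open import Data.Nat.Properties as ℕ
  using (≤-refl; ≤-trans; ≤-antisym; ≤-pred; <⇒≤; ≤-<-trans; m≤n+m; m∸n≡0⇒m≤n; m+[n∸m]≡n;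
         m<n⇒0<n∸m; +-identityʳ; +-comm; +-suc; +-cancelˡ-≤; +-cancelʳ-≤; +-monoˡ-≤; +-monoˡ-<)
open import Data.Nat.DivMod using (m≡m%n+[m/n]*n; m%n<n; m/n*n≤m)
open import Data.Nat.Divisibility as ℕ
  using (divides; _∣0; ∣-refl; ∣-trans; ∣m+n∣m⇒∣n; ∣m∣n⇒∣m+n; n∣m*n)
open import Data.Nat.Coprimality using (Coprime)
open import Data.Integer as ℤ using (ℤ; +_; -[1+_]; 0ℤ; ∣_∣; _-_; +<+; _<?_)
open import Data.Integer.Properties as ℤ using ([1+m]⊖[1+n]≡m⊖n; ⊖-≥; 0≤i⇒+∣i∣≡i)
open import Data.Integer.Divisibility using (_∣_)
import Data.Integer.Divisibility.Signed as ℤ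
open import Data.Product using (_×_; _,_; proj₁; proj₂)
open import Data.Product.Properties using (≡-dec)
open import Data.List using (List; []; _∷_)
open import Data.List.Relation.Unary.All as All using (all?)
open import Data.List.Relation.Unary.Any using (Any; any?; here)
open import Data.List.Membership.Propositional using (_∈_; find)
open import Relation.Nullary using (Dec; yes; no)
open import Relation.Nullary.Decidable using (map′; _×-dec_; _→-dec_; from-yes)
open import Relation.Binary.Definitions using (DecidableEquality)
open import Relation.Binary.PropositionalEquality
open import Function.Bundles using (_⇔_; mk⇔)
import Function.Properties.Equivalence as ⇔

⌈/⌉*-bounds : ∀ r t → let c = (r + t) / suc t in r ≤ c * suc t × c * suc t ≤ r + t
⌈/⌉*-bounds r t = r≤cs , m/n*n≤m (r + t) (suc t)
  where
  c = (r + t) / suc t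
  r≤cs : r ≤ c * suc t
  r≤cs = +-cancelʳ-≤ t r (c * suc t) (begin
    r + t                   ≡⟨ m≡m%n+[m/n]*n (r + t) (suc t) ⟩
    (r + t) % suc t + c * suc t ≤⟨ +-monoˡ-≤ (c * suc t) (≤-pred (m%n<n (r + t) (suc t))) ⟩
    t + c * suc t           ≡⟨ +-comm t (c * suc t) ⟩
    c * suc t + t           ∎)
    where open ℕ.≤-Reasoning

m<[1+m/n]*n : ∀ m n → m < suc (m / suc n) * suc n
m<[1+m/n]*n m n = begin-strict
  m                           ≡⟨ m≡m%n+[m/n]*n m (suc n) ⟩
  m % suc n + m / suc n * suc n <⟨ +-monoˡ-< (m / suc n * suc n) (m%n<n m (suc n)) ⟩
  suc n + m / suc n * suc n     ∎
  where open ℕ.≤-Reasoning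

coprime-complement : ∀ {r s c d} → r + d ≡ c * s → Coprime r s → Coprime s d
coprime-complement {r} {s} {c} {d} r+d≡cs cop {i} (i∣s , i∣d) =
  cop (∣m+n∣m⇒∣n (subst (i ℕ.∣_) (trans (sym r+d≡cs) (+-comm r d)) (∣-trans i∣s (n∣m*n c))) i∣d
      , i∣s)

coprime-shift : ∀ r k {s} → Coprime ∣ r ∣ s → Coprime ∣ r ℤ.+ + (k * s) ∣ s
coprime-shift r k {s} cop {d} (d∣r+ks , d∣s) = cop (ℤ.∣⇒∣ᵤ d∣r , d∣s)
  where
  d∣r : + d ℤ.∣ r
  d∣r = ℤ.∣m+n∣n⇒∣m (ℤ.∣ᵤ⇒∣ {+ d} {r ℤ.+ + (k * s)} d∣r+ks)
                    (ℤ.∣ᵤ⇒∣ {+ d} {+ (k * s)} (∣-trans d∣s (n∣m*n k)))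

data ℤ₃ : Set where
  0₃ 1₃ 2₃ : ℤ₃

infix 4 _≟₃_

_≟₃_ : DecidableEquality ℤ₃
0₃ ≟₃ 0₃ = yes refl
1₃ ≟₃ 1₃ = yes refl
2₃ ≟₃ 2₃ = yes refl
0₃ ≟₃ 1₃ = no λ ()
0₃ ≟₃ 2₃ = no λ ()
1₃ ≟₃ 0₃ = no λ ()
1₃ ≟₃ 2₃ = no λ ()
2₃ ≟₃ 0₃ = no λ ()
2₃ ≟₃ 1₃ = no λ ()

∀₃? : {P : ℤ₃ → Set} → (∀ x → Dec (P x)) → Dec (∀ x → P x)
∀₃? P? = map′ (λ { (p₀ , p₁ , p₂) → λ { 0₃ → p₀ ; 1₃ → p₁ ; 2₃ → p₂ } })
              (λ p → p 0₃ , p 1₃ , p 2₃)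
              (P? 0₃ ×-dec P? 1₃ ×-dec P? 2₃)

suc₃ : ℤ₃ → ℤ₃
suc₃ 0₃ = 1₃
suc₃ 1₃ = 2₃
suc₃ 2₃ = 0₃

infixl 6 _+₃_ _-₃_
infixl 7 _*₃_

_+₃_ : ℤ₃ → ℤ₃ → ℤ₃
0₃ +₃ y = y
1₃ +₃ y = suc₃ y
2₃ +₃ y = suc₃ (suc₃ y)

_*₃_ : ℤ₃ → ℤ₃ → ℤ₃
0₃ *₃ y = 0₃
1₃ *₃ y = y
2₃ *₃ y = y +₃ y

-₃_ : ℤ₃ → ℤ₃
-₃ 0₃ = 0₃
-₃ 1₃ = 2₃
-₃ 2₃ = 1₃

_-₃_ : ℤ₃ → ℤ₃ → ℤ₃
x -₃ y = x +₃ -₃ y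

canonical : ℤ₃ → ℕ
canonical 0₃ = 0
canonical 1₃ = 1
canonical 2₃ = 2

suc₃-+₃ : ∀ x y → suc₃ x +₃ y ≡ suc₃ (x +₃ y)
suc₃-+₃ = from-yes (∀₃? λ x → ∀₃? λ y → suc₃ x +₃ y ≟₃ suc₃ (x +₃ y))

suc₃-*₃ : ∀ x y → suc₃ x *₃ y ≡ y +₃ x *₃ y
suc₃-*₃ = from-yes (∀₃? λ x → ∀₃? λ y → suc₃ x *₃ y ≟₃ y +₃ x *₃ y)

suc₃³≡id : ∀ x → suc₃ (suc₃ (suc₃ x)) ≡ x
suc₃³≡id = from-yes (∀₃? λ x → suc₃ (suc₃ (suc₃ x)) ≟₃ x)

suc₃x-₃suc₃y≡x-₃y : ∀ x y → suc₃ x -₃ suc₃ y ≡ x -₃ y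
suc₃x-₃suc₃y≡x-₃y = from-yes (∀₃? λ x → ∀₃? λ y → suc₃ x -₃ suc₃ y ≟₃ x -₃ y)

+₃-identityʳ : ∀ x → x +₃ 0₃ ≡ x
+₃-identityʳ = from-yes (∀₃? λ x → x +₃ 0₃ ≟₃ x)

+₃-comm : ∀ x y → x +₃ y ≡ y +₃ x
+₃-comm = from-yes (∀₃? λ x → ∀₃? λ y → x +₃ y ≟₃ y +₃ x)

x+₃y-₃y≡x : ∀ x y → x +₃ y -₃ y ≡ x
x+₃y-₃y≡x = from-yes (∀₃? λ x → ∀₃? λ y → x +₃ y -₃ y ≟₃ x)

+₃-suc₃-*₃ : ∀ x k y → x +₃ suc₃ k *₃ y ≡ x +₃ y +₃ k *₃ y
+₃-suc₃-*₃ = from-yes (∀₃? λ x → ∀₃? λ k → ∀₃? λ y → x +₃ suc₃ k *₃ y ≟₃ x +₃ y +₃ k *₃ y)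

*₃-zeroʳ : ∀ x → x *₃ 0₃ ≡ 0₃
*₃-zeroʳ = from-yes (∀₃? λ x → x *₃ 0₃ ≟₃ 0₃)

-₃-involutive : ∀ x → -₃ -₃ x ≡ x
-₃-involutive = from-yes (∀₃? λ x → -₃ -₃ x ≟₃ x)

-₃-distrib-+₃ : ∀ x y → -₃ (x +₃ y) ≡ -₃ x +₃ -₃ y
-₃-distrib-+₃ = from-yes (∀₃? λ x → ∀₃? λ y → -₃ (x +₃ y) ≟₃ -₃ x +₃ -₃ y)

-₃x≡0₃⇒x≡0₃ : ∀ x → -₃ x ≡ 0₃ → x ≡ 0₃
-₃x≡0₃⇒x≡0₃ 0₃ _ = refl

x-₃y≡0₃⇔y≡x : ∀ x y → x -₃ y ≡ 0₃ ⇔ y ≡ x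
x-₃y≡0₃⇔y≡x x y = mk⇔ (from-yes (∀₃? λ x → ∀₃? λ y → (x -₃ y ≟₃ 0₃) →-dec (y ≟₃ x)) x y)
                      (λ { refl → from-yes (∀₃? λ x → x -₃ x ≟₃ 0₃) x })

residue : ℕ → ℤ₃
residue zero    = 0₃
residue (suc n) = suc₃ (residue n)

residue-+ : ∀ m n → residue (m + n) ≡ residue m +₃ residue n
residue-+ zero    n = refl
residue-+ (suc m) n = trans (cong suc₃ (residue-+ m n)) (sym (suc₃-+₃ (residue m) (residue n)))

residue-* : ∀ m n → residue (m * n) ≡ residue m *₃ residue n
residue-* zero    n = refl
residue-* (suc m) n = begin
  residue (n + m * n)                 ≡⟨ residue-+ n (m * n) ⟩
  residue n +₃ residue (m * n)        ≡⟨ cong (residue n +₃_) (residue-* m n) ⟩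
  residue n +₃ residue m *₃ residue n ≡⟨ suc₃-*₃ (residue m) (residue n) ⟨
  suc₃ (residue m) *₃ residue n       ∎
  where open ≡-Reasoning

residue≡0₃⇔3∣ : ∀ n → residue n ≡ 0₃ ⇔ 3 ℕ.∣ n
residue≡0₃⇔3∣ n = mk⇔ (to n) from
  where
  to : ∀ n → residue n ≡ 0₃ → 3 ℕ.∣ n
  to zero                _   = 3 ℕ.∣0
  to (suc (suc (suc n))) r≡0 = ∣m∣n⇒∣m+n ∣-refl (to n (trans (sym (suc₃³≡id (residue n))) r≡0))
  from : 3 ℕ.∣ n → residue n ≡ 0₃
  from (divides q refl) = trans (residue-* q 3) (*₃-zeroʳ (residue q))

residueℤ : ℤ → ℤ₃
residueℤ (+ n)    = residue n
residueℤ -[1+ n ] = -₃ residue (suc n)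

residueℤ-⊖ : ∀ m n → residueℤ (m ℤ.⊖ n) ≡ residue m -₃ residue n
residueℤ-⊖ zero    zero    = refl
residueℤ-⊖ zero    (suc n) = refl
residueℤ-⊖ (suc m) zero    = sym (+₃-identityʳ (residue (suc m)))
residueℤ-⊖ (suc m) (suc n) = begin
  residueℤ (suc m ℤ.⊖ suc n)         ≡⟨ cong residueℤ ([1+m]⊖[1+n]≡m⊖n m n) ⟩
  residueℤ (m ℤ.⊖ n)                 ≡⟨ residueℤ-⊖ m n ⟩
  residue m -₃ residue n             ≡⟨ suc₃x-₃suc₃y≡x-₃y (residue m) (residue n) ⟨
  residue (suc m) -₃ residue (suc n) ∎
  where open ≡-Reasoning

residueℤ-+ : ∀ i j → residueℤ (i ℤ.+ j) ≡ residueℤ i +₃ residueℤ j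
residueℤ-+ (+ m)    (+ n)    = residue-+ m n
residueℤ-+ (+ m)    -[1+ n ] = residueℤ-⊖ m (suc n)
residueℤ-+ -[1+ m ] (+ n)    = trans (residueℤ-⊖ n (suc m)) (+₃-comm (residue n) _)
residueℤ-+ -[1+ m ] -[1+ n ] = begin
  -₃ residue (suc (suc (m + n)))           ≡⟨ cong (λ k → -₃ residue (suc k)) (+-suc m n) ⟨
  -₃ residue (suc m + suc n)               ≡⟨ cong (λ x → -₃ x) (residue-+ (suc m) (suc n)) ⟩
  -₃ (residue (suc m) +₃ residue (suc n))  ≡⟨ -₃-distrib-+₃ (residue (suc m)) (residue (suc n)) ⟩
  -₃ residue (suc m) +₃ -₃ residue (suc n) ∎
  where open ≡-Reasoning

residueℤ-neg : ∀ i → residueℤ (ℤ.- i) ≡ -₃ residueℤ i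
residueℤ-neg (+ zero)  = refl
residueℤ-neg (+ suc n) = refl
residueℤ-neg -[1+ n ]  = sym (-₃-involutive (residue (suc n)))

residueℤ≡0₃⇔3∣ : ∀ i → residueℤ i ≡ 0₃ ⇔ + 3 ∣ i
residueℤ≡0₃⇔3∣ (+ n)    = residue≡0₃⇔3∣ n
residueℤ≡0₃⇔3∣ -[1+ n ] = ⇔.trans (mk⇔ (-₃x≡0₃⇒x≡0₃ _) (cong (λ x → -₃ x))) (residue≡0₃⇔3∣ (suc n))

3∣s-r⇔residues-equal : ∀ r s → + 3 ∣ (+ s - r) ⇔ residueℤ r ≡ residue s
3∣s-r⇔residues-equal r s = ⇔.trans (⇔.sym (residueℤ≡0₃⇔3∣ (+ s - r)))
  (subst (λ x → x ≡ 0₃ ⇔ residueℤ r ≡ residue s) (sym residue-s-r)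
    (x-₃y≡0₃⇔y≡x (residue s) (residueℤ r)))
  where
  residue-s-r : residueℤ (+ s - r) ≡ residue s -₃ residueℤ r
  residue-s-r = trans (residueℤ-+ (+ s) (ℤ.- r)) (cong (residue s +₃_) (residueℤ-neg r))

mod3-periodic : {A : Set} (f : ℕ → A) (g : A → A) → (∀ n → f (suc n) ≡ g (f n)) →
  g (g (g (f 0))) ≡ f 0 → ∀ n → f n ≡ f (canonical (residue n))
mod3-periodic f g step period zero    = refl
mod3-periodic f g step period (suc n) =
  trans (step n) (trans (cong g (mod3-periodic f g step period n)) (g-canonical (residue n)))
  where
  g-canonical : ∀ k → g (f (canonical k)) ≡ f (canonical (suc₃ k))
  g-canonical 0₃ = sym (step 0)
  g-canonical 1₃ = sym (step 1)
  g-canonical 2₃ = trans (cong g (trans (step 1) (cong g (step 0)))) period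

M⁻ω : ℕ → Eis × Eis → Eis × Eis
M⁻ω c (x , y) = [ c ]ω ⊗ x ⊖ ω^ (c ∸ 1) ⊗ y , x

applyM-∷ : ∀ c cs → applyM (c ∷ cs) ≡ M⁻ω c (applyM cs)
applyM-∷ c cs with applyM cs
... | x , y = refl

M⁻ω-mod3 : ∀ c p → M⁻ω (suc c) p ≡ M⁻ω (suc (canonical (residue c))) p
M⁻ω-mod3 c (x , y) =
  cong₂ (λ a b → a ⊗ x ⊖ b ⊗ y , x)
    (cong (λ a → 𝟙 ⊕ ω ⊗ a) (mod3-periodic [_]ω (λ a → 𝟙 ⊕ ω ⊗ a) (λ _ → refl) refl c))
    (mod3-periodic ω^ (ω ⊗_) (λ _ → refl) refl c)

units : List Eis
units = 𝟙 ∷ ω ∷ ω⁻¹ ∷ ⊝ 𝟙 ∷ ⊝ ω ∷ ⊝ ω⁻¹ ∷ []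

scale : Eis → Eis × Eis → Eis × Eis
scale u (x , y) = u ⊗ x , u ⊗ y

infix 4 _∼_

_∼_ : Eis × Eis → Eis × Eis → Set
p ∼ q = Any (λ u → p ≡ scale u q) units

_≟ᴱ_ : DecidableEquality Eis
eis a b ≟ᴱ eis c d =
  map′ (λ { (refl , refl) → refl }) (λ { refl → refl , refl }) (a ℤ.≟ c ×-dec b ℤ.≟ d)

_∼?_ : ∀ p q → Dec (p ∼ q)
p ∼? q = any? (λ u → ≡-dec _≟ᴱ_ _≟ᴱ_ p (scale u q)) units

∀ᵤ? : {P : Eis → Set} → (∀ u → Dec (P u)) → Dec (∀ {u} → u ∈ units → P u)
∀ᵤ? P? = map′ All.lookup All.tabulate (all? P? units)

∼-map : ∀ (f : Eis × Eis → Eis × Eis) {p q q′} →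
  (∀ {u} → u ∈ units → f (scale u q) ∼ q′) → p ∼ q → f p ∼ q′
∼-map f f-scale p∼q with find p∼q
... | u , u∈ , refl = f-scale u∈

shape : ℤ₃ → ℤ₃ → Eis × Eis
shape 0₃ 0₃ = 𝟘 , 𝟘   -- never reached: r and s are coprime
shape 0₃ _  = 𝟘 , 𝟙
shape _  0₃ = 𝟙 , 𝟘
shape 1₃ 1₃ = 𝟙 , 𝟙
shape 2₃ 2₃ = 𝟙 , 𝟙
shape 1₃ 2₃ = 𝟙 , ⊝ ω
shape 2₃ 1₃ = 𝟙 , ⊝ ω

M⁻ω-shape : ∀ {u} → u ∈ units → ∀ k b e →
  M⁻ω (suc (canonical k)) (scale u (shape b e)) ∼ shape (suc₃ k *₃ b -₃ e) b
M⁻ω-shape = from-yes (∀ᵤ? λ u → ∀₃? λ k → ∀₃? λ b → ∀₃? λ e →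
  M⁻ω (suc (canonical k)) (scale u (shape b e)) ∼? shape (suc₃ k *₃ b -₃ e) b)

stepDown-shape : ∀ {u} → u ∈ units → ∀ a b → stepDown (scale u (shape a b)) ∼ shape (a -₃ b) b
stepDown-shape = from-yes (∀ᵤ? λ u → ∀₃? λ a → ∀₃? λ b →
  stepDown (scale u (shape a b)) ∼? shape (a -₃ b) b)

scale-shape-diagonal : ∀ {u} → u ∈ units → ∀ a b →
  proj₁ (scale u (shape a b)) ≡ proj₂ (scale u (shape a b)) → a ≡ b
scale-shape-diagonal = from-yes (∀ᵤ? λ u → ∀₃? λ a → ∀₃? λ b →
  (proj₁ (scale u (shape a b)) ≟ᴱ proj₂ (scale u (shape a b))) →-dec (a ≟₃ b))

∼shape⇒[proj₁≡proj₂⇔≡] : ∀ {p} a b → p ∼ shape a b → proj₁ p ≡ proj₂ p ⇔ a ≡ b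
∼shape⇒[proj₁≡proj₂⇔≡] a b p∼ with find p∼
... | u , u∈ , refl = mk⇔ (scale-shape-diagonal u∈ a b) λ { refl → shape-diagonal a }
  where
  shape-diagonal : ∀ a → proj₁ (scale u (shape a a)) ≡ proj₂ (scale u (shape a a))
  shape-diagonal 0₃ = refl
  shape-diagonal 1₃ = refl
  shape-diagonal 2₃ = refl

applyM[]-shape : ∀ {s} → s ≡ 1 → applyM [] ∼ shape (residue s) 0₃
applyM[]-shape refl = here refl

applyM-∷-shape : ∀ {r s d} c cs → 1 ≤ r → r + d ≡ c * s →
  applyM cs ∼ shape (residue s) (residue d) → applyM (c ∷ cs) ∼ shape (residue r) (residue s)
applyM-∷-shape zero    cs (s≤s _) ()
applyM-∷-shape {r} {s} {d} (suc c) cs _ r+d≡cs cs∼ =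
  subst₂ (λ p a → p ∼ shape a (residue s))
    (sym (trans (applyM-∷ (suc c) cs) (M⁻ω-mod3 c (applyM cs)))) residue-r
    (∼-map (M⁻ω (suc (canonical (residue c))))
      (λ u∈ → M⁻ω-shape u∈ (residue c) (residue s) (residue d)) cs∼)
  where
  open ≡-Reasoning
  residue-r : residue (suc c) *₃ residue s -₃ residue d ≡ residue r
  residue-r = begin
    residue (suc c) *₃ residue s -₃ residue d ≡⟨ cong (_-₃ residue d) (residue-* (suc c) s) ⟨
    residue (suc c * s) -₃ residue d          ≡⟨ cong (λ n → residue n -₃ residue d) r+d≡cs ⟨
    residue (r + d) -₃ residue d              ≡⟨ cong (_-₃ residue d) (residue-+ r d) ⟩
    residue r +₃ residue d -₃ residue d       ≡⟨ x+₃y-₃y≡x (residue r) (residue d) ⟩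
    residue r                                 ∎

ncf-shape : ∀ f {r s} → 1 ≤ r → s ≤ f → Coprime r s →
  applyM (ncf f r s) ∼ shape (residue r) (residue s)
ncf-shape zero    {r} {zero} _ _ cop = applyM[]-shape (cop (∣-refl , r ℕ.∣0))
ncf-shape (suc f) {r} {zero} _ _ cop = applyM[]-shape (cop (∣-refl , r ℕ.∣0))
ncf-shape (suc f) {r} {suc t} 1≤r (s≤s t≤f) cop with (r + t) / suc t | ⌈/⌉*-bounds r t
... | c | r≤cs , cs≤r+t with c * suc t ∸ r in cs-r
...   | zero  = applyM-∷-shape {d = 0} c [] 1≤r r+0≡cs (applyM[]-shape s≡1)
  where
  cs≡r : c * suc t ≡ r
  cs≡r = ≤-antisym (m∸n≡0⇒m≤n cs-r) r≤cs
  r+0≡cs : r + 0 ≡ c * suc t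
  r+0≡cs = trans (+-identityʳ r) (sym cs≡r)
  s≡1 : suc t ≡ 1
  s≡1 = cop (divides c (sym cs≡r) , ∣-refl)
...   | suc d = applyM-∷-shape c (ncf f (suc t) (suc d)) 1≤r r+d≡cs
                  (ncf-shape f (s≤s z≤n) (≤-trans d<s t≤f) (coprime-complement {c = c} r+d≡cs cop))
  where
  r+d≡cs : r + suc d ≡ c * suc t
  r+d≡cs = trans (cong (λ n → r + n) (sym cs-r)) (m+[n∸m]≡n r≤cs)
  d<s : suc d ≤ t
  d<s = +-cancelˡ-≤ r (suc d) t (subst (_≤ r + t) (sym r+d≡cs) cs≤r+t)

iterate-stepDown-shape : ∀ k a b {p} →
  p ∼ shape (a +₃ residue k *₃ b) b → iterate k stepDown p ∼ shape a b
iterate-stepDown-shape zero    a b {p} p∼ = subst (λ a′ → p ∼ shape a′ b) (+₃-identityʳ a) p∼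
iterate-stepDown-shape (suc k) a b {p} p∼ =
  subst (λ a′ → iterate (suc k) stepDown p ∼ shape a′ b) (x+₃y-₃y≡x a b)
    (∼-map stepDown (λ u∈ → stepDown-shape u∈ (a +₃ b) b)
      (iterate-stepDown-shape k (a +₃ b) b
        (subst (λ a′ → p ∼ shape a′ b) (+₃-suc₃-*₃ a (residue k) b) p∼)))

downSteps : ℤ → ℕ → ℕ
downSteps r t = suc (∣ + suc t - r ∣ / suc t)

downSteps-positive : ∀ r t → 0ℤ ℤ.< r ℤ.+ + (downSteps r t * suc t)
downSteps-positive (+ n)    t = +<+ (≤-trans (s≤s z≤n) (m≤n+m _ n))
downSteps-positive -[1+ m ] t = subst (0ℤ ℤ.<_) (sym (⊖-≥ (<⇒≤ m<ks))) (+<+ (m<n⇒0<n∸m m<ks))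
  where
  m<ks : suc m < downSteps -[1+ m ] t * suc t
  m<ks = ≤-<-trans (m≤n+m (suc m) (suc t)) (m<[1+m/n]*n (suc t + suc m) t)

RSω-shape : ∀ r s → 0 < s → Coprime ∣ r ∣ s → RSω r s ∼ shape (residueℤ r) (residue s)
RSω-shape r (suc t) _ cop with + suc t <? r
... | yes (+<+ s<n) = ncf-shape (suc t) (≤-trans (s≤s z≤n) s<n) ≤-refl cop
... | no _ = iterate-stepDown-shape k (residueℤ r) (residue s)
               (subst (λ a → applyM (ncf s r′ s) ∼ shape a (residue s)) residue-r′
                 (ncf-shape s (abs-positive 0<r+ks) ≤-refl (coprime-shift r k cop)))
  where
  s = suc t
  k = downSteps r t
  r′ = ∣ r ℤ.+ + (k * s) ∣
  0<r+ks : 0ℤ ℤ.< r ℤ.+ + (k * s)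
  0<r+ks = downSteps-positive r t
  abs-positive : ∀ {i} → 0ℤ ℤ.< i → 0 < ∣ i ∣
  abs-positive (+<+ 0<n) = 0<n
  residue-r′ : residue r′ ≡ residueℤ r +₃ residue k *₃ residue s
  residue-r′ = begin
    residueℤ (+ r′)                      ≡⟨ cong residueℤ (0≤i⇒+∣i∣≡i (ℤ.<⇒≤ 0<r+ks)) ⟩
    residueℤ (r ℤ.+ + (k * s))           ≡⟨ residueℤ-+ r (+ (k * s)) ⟩
    residueℤ r +₃ residue (k * s)        ≡⟨ cong (residueℤ r +₃_) (residue-* k s) ⟩
    residueℤ r +₃ residue k *₃ residue s ∎
    where open ≡-Reasoning

corollary7p4 : (r : ℤ) (s : ℕ) → 0 < s → Coprime ∣ r ∣ s →
    ((+ 3 ∣ (+ s - r)) ⇔ (Rω r s ≡ Sω r s))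
corollary7p4 r s 0<s cop =
  ⇔.trans (3∣s-r⇔residues-equal r s)
          (⇔.sym (∼shape⇒[proj₁≡proj₂⇔≡] (residueℤ r) (residue s) (RSω-shape r s 0<s cop)))
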